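{- For positive integers $m,n$, $RR(C_m,C_n)=(m-1)(n-1)$.
   Context: For a positive integer $N$, $\mathcal{B}_N$ denotes the Boolean lattice of all subsets of $[N]=\{1,\dots,N\}$ ordered by inclusion. A family $\mathcal{G}$ of sets is a copy of a poset $P$ if there is a bijection $\phi:P\to\mathcal{G}$ with $x<_P y$ if and only if $\phi(x)\subsetneq\phi(y)$. A coloring of $\mathcal{B}_N$ is any map from $\mathcal{B}_N$ to the positive integers. Under a coloring, a monochromatic $P$ is a copy of $P$ all of whose sets have the same color, and a rainbow $Q$ is a copy of $Q$ whose sets have pairwise distinct colors. $RR(P,Q)$ is the minimum integer $N$ such that every coloring of $\mathcal{B}_N$ contains a monochromatic $P$ or a rainbow $Q$. $C_k$ denotes the chain (totally ordered set) with $k$ elements. -}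

module Defs where

open import Data.Nat using (ℕ; _≤_; _*_; _∸_)
open import Data.Fin using (Fin) renaming (_<_ to _<ᶠ_)
open import Data.Fin.Subset using (Subset; _⊂_)
open import Data.Product using (Σ; _×_)
open import Data.Sum using (_⊎_)
open import Function.Bundles using (_⇔_)
open import Relation.Binary.PropositionalEquality using (_≡_)

-- The Boolean lattice B_N: all subsets of an N-element ground set, i.e. Subset N.
-- The chain C_k is Fin k with its strict order.

-- A copy of C_k in B_N: a map φ : Fin k → Subset N with  i < j  iff  φ i ⊊ φ j.
-- (This forces φ to be injective, hence a bijection onto its image family.)
IsChainCopy : {N : ℕ} (k : ℕ) → (Fin k → Subset N) → Set
IsChainCopy k φ = ∀ (i j : Fin k) → (i <ᶠ j) ⇔ (φ i ⊂ φ j)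

-- A coloring of B_N (colors are natural numbers; only (in)equality of colors matters).
Coloring : ℕ → Set
Coloring N = Subset N → ℕ

MonoChain : {N : ℕ} → Coloring N → ℕ → Set
MonoChain {N} c k = Σ (Fin k → Subset N) λ φ →
  IsChainCopy k φ × (∀ (i j : Fin k) → c (φ i) ≡ c (φ j))

RainbowChain : {N : ℕ} → Coloring N → ℕ → Set
RainbowChain {N} c k = Σ (Fin k → Subset N) λ φ →
  IsChainCopy k φ × (∀ (i j : Fin k) → c (φ i) ≡ c (φ j) → i ≡ j)

Arrows : ℕ → ℕ → ℕ → Set
Arrows m n N = ∀ (c : Coloring N) → MonoChain c m ⊎ RainbowChain c n

IsRR : ℕ → ℕ → ℕ → Set
IsRR m n R = Arrows m n R × (∀ N → Arrows m n N → R ≤ N)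

module Submission where

-- Colour a set S by ⌊|S|/(m-1)⌋.  Sizes along a chain are distinct, so a
-- monochromatic C_m would need m distinct sizes within m-1 consecutive levels,
-- and when N < (m-1)(n-1) there are only n-1 colours, too few for a rainbow C_n.
-- Conversely, a maximal chain of B_N with N = (m-1)(n-1) has (m-1)(n-1)+1 sets,
-- and any colouring of that many elements has m of one colour or n of distinct
-- colours: either m-1 later elements share the colour of the first, or at least
-- (m-1)(n-2)+1 do not, and the first element extends a rainbow found among them.

open import Defs
open import Data.Nat using (ℕ; _≤_; _*_; _∸_)
open import Data.Nat.Base using (zero; suc; _+_; _<_; z≤n; s≤s; NonZero)
open import Data.Nat.Properties
  using (_≟_; _≤?_; ≰⇒>; ≮⇒≥; n≮n; m≤n⇒m⊓n≡m; *-suc; *-comm; +-cancelˡ-<; +-suc; +-monoˡ-<; ≤-<-trans; n<1+n; <⇒≢; module ≤-Reasoning)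
open import Data.Nat.DivMod using (_/_; _%_; m≡m%n+[m/n]*n; m%n<n; m<n*o⇒m/o<n)
open import Data.Fin as Fin using (Fin) renaming (_<_ to _<ᶠ_)
open import Data.Fin.Properties using (<-cmp; fromℕ<-injective; injective⇒≤)
open import Data.Fin.Subset using (Subset; _⊂_; inside; ⊥; ∣_∣)
open import Data.Fin.Subset.Properties using (⊂-irref; ⊂-asymmetric; p⊂q⇒∣p∣<∣q∣; in⊂in; out⊂in; ⊥⊆; ∣p∣≤n)
open import Data.Vec using ([]; _∷_)
open import Data.List using (List; []; _∷_; length; lookup; map; filter; take)
open import Data.List.Properties using (length-map; length-take)
open import Data.List.Relation.Unary.All as All using (All; []; _∷_)
open import Data.List.Relation.Unary.All.Properties using (all-filter)
import Data.List.Relation.Unary.All.Properties as All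
open import Data.List.Relation.Unary.AllPairs as AllPairs using (AllPairs; []; _∷_)
import Data.List.Relation.Unary.AllPairs.Properties as AllPairs
open import Data.List.Relation.Binary.Sublist.Propositional using (_⊆_; []; _∷_; _∷ʳ_; ⊆-trans; minimum)
open import Data.List.Relation.Binary.Sublist.Propositional.Properties using (All-resp-⊆; filter-⊆; take-⊆)
open import Data.Product using (∃; _×_; _,_)
open import Data.Sum using (_⊎_; inj₁; inj₂; [_,_])
open import Data.Empty using (⊥-elim)
open import Function.Base using (_∘_)
open import Level using (0ℓ)
open import Function.Bundles using (mk⇔; Equivalence)
open import Function.Definitions using (Injective)
open import Relation.Binary using (Rel; tri<; tri≈; tri>)
open import Relation.Binary.PropositionalEquality using (_≡_; _≢_; refl; sym; trans; cong; cong₂; subst; module ≡-Reasoning)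
open import Relation.Nullary using (¬_; yes; no)
open import Relation.Unary using (Pred; Decidable)
open import Relation.Unary.Properties using (∁?)

AllPairs-resp-⊇ : ∀ {A : Set} {R : Rel A 0ℓ} {xs ys : List A} → xs ⊆ ys → AllPairs R ys → AllPairs R xs
AllPairs-resp-⊇ [] [] = []
AllPairs-resp-⊇ (y ∷ʳ τ) (_ ∷ rys) = AllPairs-resp-⊇ τ rys
AllPairs-resp-⊇ (refl ∷ τ) (ry ∷ rys) = All-resp-⊆ τ ry ∷ AllPairs-resp-⊇ τ rys

length-filter+length-filter-∁ : ∀ {A : Set} {P : Pred A 0ℓ} (P? : Decidable P) xs →
  length (filter P? xs) + length (filter (∁? P?) xs) ≡ length xs
length-filter+length-filter-∁ P? [] = refl
length-filter+length-filter-∁ P? (x ∷ xs) with P? x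
... | yes _ = cong suc (length-filter+length-filter-∁ P? xs)
... | no _ = trans (+-suc _ _) (cong suc (length-filter+length-filter-∁ P? xs))

m*[1+k]≤f+g⇒f<m⇒m*k<g : ∀ {m k f g} → m * suc k ≤ f + g → f < m → m * k < g
m*[1+k]≤f+g⇒f<m⇒m*k<g {m} {k} {f} {g} m*[1+k]≤f+g f<m = +-cancelˡ-< m (m * k) g (begin-strict
  m + m * k  ≡⟨ *-suc m k ⟨
  m * suc k  ≤⟨ m*[1+k]≤f+g ⟩
  f + g      <⟨ +-monoˡ-< g f<m ⟩
  m + g      ∎)
  where open ≤-Reasoning

module _ {A : Set} (c : A → ℕ) where

  Monochromatic : List A → Set
  Monochromatic xs = ∃ λ colour → All (λ x → c x ≡ colour) xs

  Rainbow : List A → Set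
  Rainbow = AllPairs (λ x y → c x ≢ c y)

  sameColour? : (x : A) → Decidable (λ y → c y ≡ c x)
  sameColour? x y = c y ≟ c x

  sameColourAs otherColourThan : A → List A → List A
  sameColourAs x = filter (sameColour? x)
  otherColourThan x = filter (∁? (sameColour? x))

  monochromatic-or-rainbow-sublist : ∀ m k xs → m * k < length xs →
    (∃ λ ys → ys ⊆ xs × length ys ≡ suc m × Monochromatic ys) ⊎
    (∃ λ ys → ys ⊆ xs × length ys ≡ suc k × Rainbow ys)
  monochromatic-or-rainbow-sublist m k (x ∷ xs) (s≤s m*k≤∣xs∣) with m ≤? length (sameColourAs x xs)
  ... | yes m≤∣same∣ = inj₁ (x ∷ take m (sameColourAs x xs) ,
    refl ∷ ⊆-trans (take-⊆ m _) (filter-⊆ (sameColour? x) xs) ,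
    cong suc (trans (length-take m _) (m≤n⇒m⊓n≡m m≤∣same∣)) ,
    c x , refl ∷ All-resp-⊆ (take-⊆ m _) (all-filter (sameColour? x) xs))
  ... | no m≰∣same∣ with k
  ...   | zero = inj₂ (x ∷ [] , refl ∷ minimum xs , refl , [] ∷ [])
  ...   | suc k′ with monochromatic-or-rainbow-sublist m k′ (otherColourThan x xs)
                   (m*[1+k]≤f+g⇒f<m⇒m*k<g
                     (subst (m * suc k′ ≤_) (sym (length-filter+length-filter-∁ (sameColour? x) xs)) m*k≤∣xs∣)
                     (≰⇒> m≰∣same∣))
  ...     | inj₁ (ys , τ , ∣ys∣ , mono) =
    inj₁ (ys , ⊆-trans τ (x ∷ʳ filter-⊆ (∁? (sameColour? x)) xs) , ∣ys∣ , mono)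
  ...     | inj₂ (ys , τ , ∣ys∣ , rainbow) =
    inj₂ (x ∷ ys , refl ∷ ⊆-trans τ (filter-⊆ (∁? (sameColour? x)) xs) , cong suc ∣ys∣ ,
          All-resp-⊆ τ (All.map (_∘ sym) (all-filter (∁? (sameColour? x)) xs)) ∷ rainbow)

All-lookup : ∀ {A : Set} {P : Pred A 0ℓ} {xs : List A} → All P xs → ∀ i → P (lookup xs i)
All-lookup (px ∷ _) Fin.zero = px
All-lookup (_ ∷ pxs) (Fin.suc i) = All-lookup pxs i

AllPairs-lookup : ∀ {A : Set} {R : Rel A 0ℓ} {xs : List A} → AllPairs R xs →
  ∀ {i j} → i <ᶠ j → R (lookup xs i) (lookup xs j)
AllPairs-lookup (rx ∷ _) {Fin.zero} {Fin.suc j} _ = All-lookup rx j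
AllPairs-lookup (_ ∷ rxs) {Fin.suc i} {Fin.suc j} (s≤s i<j) = AllPairs-lookup rxs i<j

lookup-isChainCopy : ∀ {N} {ys : List (Subset N)} → AllPairs _⊂_ ys → IsChainCopy (length ys) (lookup ys)
lookup-isChainCopy {ys = ys} chain i j = mk⇔ (AllPairs-lookup chain) ⊂⇒<
  where
  ⊂⇒< : lookup ys i ⊂ lookup ys j → i <ᶠ j
  ⊂⇒< yᵢ⊂yⱼ with <-cmp i j
  ... | tri< i<j _ _ = i<j
  ... | tri≈ _ refl _ = ⊥-elim (⊂-irref refl yᵢ⊂yⱼ)
  ... | tri> _ _ j<i = ⊥-elim (⊂-asymmetric yᵢ⊂yⱼ (AllPairs-lookup chain j<i))

module _ {N} (c : Coloring N) {ys : List (Subset N)} (chain : AllPairs _⊂_ ys) where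

  monoChain : Monochromatic c ys → MonoChain c (length ys)
  monoChain (_ , mono) = lookup ys , lookup-isChainCopy chain ,
    λ i j → trans (All-lookup mono i) (sym (All-lookup mono j))

  rainbowChain : Rainbow c ys → RainbowChain c (length ys)
  rainbowChain rainbow = lookup ys , lookup-isChainCopy chain , injective
    where
    injective : ∀ i j → c (lookup ys i) ≡ c (lookup ys j) → i ≡ j
    injective i j cᵢ≡cⱼ with <-cmp i j
    ... | tri< i<j _ _ = ⊥-elim (AllPairs-lookup rainbow i<j cᵢ≡cⱼ)
    ... | tri≈ _ i≡j _ = i≡j
    ... | tri> _ _ j<i = ⊥-elim (AllPairs-lookup rainbow j<i (sym cᵢ≡cⱼ))

maximalChain : ∀ N → List (Subset N)
maximalChain zero = [] ∷ []
maximalChain (suc N) = ⊥ ∷ map (inside ∷_) (maximalChain N)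

length-maximalChain : ∀ N → length (maximalChain N) ≡ suc N
length-maximalChain zero = refl
length-maximalChain (suc N) = cong suc (trans (length-map (inside ∷_) (maximalChain N)) (length-maximalChain N))

maximalChain-⊂ : ∀ N → AllPairs _⊂_ (maximalChain N)
maximalChain-⊂ zero = [] ∷ []
maximalChain-⊂ (suc N) =
  All.map⁺ (All.universal (λ _ → out⊂in ⊥⊆) (maximalChain N)) ∷
  AllPairs.map⁺ (AllPairs.map in⊂in (maximalChain-⊂ N))

m*k-arrows : ∀ m k → Arrows (suc m) (suc k) (m * k)
m*k-arrows m k c
  with monochromatic-or-rainbow-sublist c m k (maximalChain (m * k))
         (subst (m * k <_) (sym (length-maximalChain (m * k))) (n<1+n (m * k)))
... | inj₁ (ys , τ , ∣ys∣ , mono) =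
  inj₁ (subst (MonoChain c) ∣ys∣ (monoChain c (AllPairs-resp-⊇ τ (maximalChain-⊂ _)) mono))
... | inj₂ (ys , τ , ∣ys∣ , rainbow) =
  inj₂ (subst (RainbowChain c) ∣ys∣ (rainbowChain c (AllPairs-resp-⊇ τ (maximalChain-⊂ _)) rainbow))

injective-bounded⇒≤ : ∀ {m n} (f : Fin m → ℕ) (f<n : ∀ i → f i < n) → Injective _≡_ _≡_ f → m ≤ n
injective-bounded⇒≤ f f<n f-injective =
  injective⇒≤ (λ {i} {j} eq → f-injective (fromℕ<-injective (f i) (f j) (f<n i) (f<n j) eq))

/-%-injective : ∀ {m p} n .{{_ : NonZero n}} → m / n ≡ p / n → m % n ≡ p % n → m ≡ p
/-%-injective {m} {p} n m/n≡p/n m%n≡p%n = begin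
  m                  ≡⟨ m≡m%n+[m/n]*n m n ⟩
  m % n + m / n * n  ≡⟨ cong₂ (λ r q → r + q * n) m%n≡p%n m/n≡p/n ⟩
  p % n + p / n * n  ≡⟨ m≡m%n+[m/n]*n p n ⟨
  p                  ∎
  where open ≡-Reasoning

size-injective : ∀ {N k} {φ : Fin k → Subset N} → IsChainCopy k φ → Injective _≡_ _≡_ (∣_∣ ∘ φ)
size-injective {φ = φ} copy {i} {j} ∣φi∣≡∣φj∣ with <-cmp i j
... | tri< i<j _ _ = ⊥-elim (<⇒≢ (p⊂q⇒∣p∣<∣q∣ (Equivalence.to (copy i j) i<j)) ∣φi∣≡∣φj∣)
... | tri≈ _ i≡j _ = i≡j
... | tri> _ _ j<i = ⊥-elim (<⇒≢ (p⊂q⇒∣p∣<∣q∣ (Equivalence.to (copy j i) j<i)) (sym ∣φi∣≡∣φj∣))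

levelBlocks : ∀ {N} a .{{_ : NonZero a}} → Coloring N
levelBlocks a S = ∣ S ∣ / a

levelBlocks-¬MonoChain : ∀ {N} a .{{_ : NonZero a}} → ¬ MonoChain (levelBlocks {N} a) (suc a)
levelBlocks-¬MonoChain a (φ , copy , mono) = n≮n a (injective-bounded⇒≤
  (λ i → ∣ φ i ∣ % a) (λ i → m%n<n ∣ φ i ∣ a)
  (λ {i} {j} → size-injective copy ∘ /-%-injective a (mono i j)))

levelBlocks-¬RainbowChain : ∀ {N} a k .{{_ : NonZero a}} → N < a * k →
  ¬ RainbowChain (levelBlocks {N} a) (suc k)
levelBlocks-¬RainbowChain {N} a k N<a*k (φ , _ , rainbow) = n≮n k (injective-bounded⇒≤
  (levelBlocks a ∘ φ) (λ i → m<n*o⇒m/o<n (≤-<-trans (∣p∣≤n (φ i)) (subst (N <_) (*-comm a k) N<a*k)))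
  (rainbow _ _))

arrows⇒m*k≤ : ∀ m k N → Arrows (suc m) (suc k) N → m * k ≤ N
arrows⇒m*k≤ zero k N _ = z≤n
arrows⇒m*k≤ m@(suc _) k N arrows = ≮⇒≥ λ N<m*k →
  [ levelBlocks-¬MonoChain m , levelBlocks-¬RainbowChain m k N<m*k ] (arrows (levelBlocks m))

mainTheorem2 : ∀ (m n : ℕ) → 1 ≤ m → 1 ≤ n →
    IsRR m n ((m ∸ 1) * (n ∸ 1))
mainTheorem2 zero _ () _
mainTheorem2 (suc _) zero _ ()
mainTheorem2 (suc m) (suc k) _ _ = m*k-arrows m k , arrows⇒m*k≤ m k
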